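{- Let $d\geq n$ be positive integers, let $H_1,\ldots,H_q\subseteq[d]$ and positive integers $r_1,\ldots,r_q$ satisfy $|H_i\cap H_j|\leq r_i+r_j-n$ for all $i\neq j$, and $|[d]\setminus H_i|\geq n-r_i$, $r_i\leq n-1$, $|H_i|\geq r_i+1$ for all $i$. Let $M$ be the elementary split matroid of $\mathcal{H}=\{H_1,\ldots,H_q\}$. Then $$\dim_{\mathrm{naive}}(\Gamma_M)=nd-\sum_{i=1}^q(n-r_i)(|H_i|-r_i).$$
   Context: Elementary split matroid: the matroid of rank $n$ on $[d]$ whose independent sets are $\{X\subseteq[d]:|X|\leq n,\ |X\cap H_i|\leq r_i\ \forall i\}$. Subspaces: for a matroid of rank $n$, circuits of size at most $n$ are grouped into classes by $C_1\sim C_2\iff \mathrm{cl}(C_1)=\mathrm{cl}(C_2)$; each class $l$ is a subspace, $\mathrm{rank}(l)$ is the rank of its circuits, $l$ is identified with the set of points lying in some circuit of the class and $|l|$ is its cardinality; $\mathcal{L}_M$ is the set of subspaces. Naive dimension: $\dim_{\mathrm{naive}}(\Gamma_M)=nd-\sum_{l\in\mathcal{L}_M}(|l|-\mathrm{rank}(l))(n-\mathrm{rank}(l))$. -}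

module Defs where

open import Data.Bool using (Bool; true; false; _∧_; _∨_; not; if_then_else_)
open import Data.Nat using (ℕ; zero; suc; _≤ᵇ_; _⊔_; _≡ᵇ_)
open import Data.Fin using (Fin)
open import Data.Fin.Subset using (Subset; outside; inside; _∩_; _∪_; ∁; ∣_∣; ⁅_⁆; ⊥)
open import Data.Vec using (Vec; []; _∷_; tabulate; replicate)
open import Data.List using (List; []; _∷_; map; filter; foldr; allFin; _++_)
open import Data.Bool.ListAction using (any; all)
open import Data.Integer as ℤ using (ℤ; +_)
open import Relation.Nullary.Decidable using (does)
open import Relation.Binary.PropositionalEquality using (_≡_)
open import Data.Bool.Properties using (T?)

allSubsets : (d : ℕ) → List (Subset d)
allSubsets zero = [] ∷ []
allSubsets (suc d) = map (outside ∷_) (allSubsets d) ++ map (inside ∷_) (allSubsets d)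

_⊆ᵇ_ : ∀ {d} → Subset d → Subset d → Bool
[] ⊆ᵇ [] = true
(x ∷ xs) ⊆ᵇ (y ∷ ys) = ((not x) ∨ y) ∧ (xs ⊆ᵇ ys)

_=ˢ_ : ∀ {d} → Subset d → Subset d → Bool
X =ˢ Y = (X ⊆ᵇ Y) ∧ (Y ⊆ᵇ X)

bigUnion : ∀ {d} → List (Subset d) → Subset d
bigUnion = foldr _∪_ ⊥

-- A (candidate) matroid on [d], given by its (decidable) independence test.

Indep : ℕ → Set
Indep d = Subset d → Bool

module MatroidNotions {d : ℕ} (ind : Indep d) where

  rank : Subset d → ℕ
  rank X = foldr _⊔_ 0
    (map ∣_∣ (filter (λ Y → T? ((Y ⊆ᵇ X) ∧ ind Y)) (allSubsets d)))

  cl : Subset d → Subset d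
  cl X = tabulate (λ x → rank (X ∪ ⁅ x ⁆) ≡ᵇ rank X)

  isCircuit : Subset d → Bool
  isCircuit C = not (ind C) ∧
    all (λ Y → not ((Y ⊆ᵇ C) ∧ not (Y =ˢ C)) ∨ ind Y) (allSubsets d)

  smallCircuits : ℕ → List (Subset d)
  smallCircuits n = filter (λ C → T? (isCircuit C ∧ (∣ C ∣ ≤ᵇ n))) (allSubsets d)

  -- Subspaces: classes of small circuits under C₁ ∼ C₂ ⇔ cl C₁ = cl C₂.
  -- A class is indexed (bijectively) by the common closure F of its circuits;
  -- the classes are the F (among all subsets, listed without repetition)
  -- which are the closure of some small circuit.
  isClassClosure : ℕ → Subset d → Bool
  isClassClosure n F = any (λ C → cl C =ˢ F) (smallCircuits n)

  classClosures : ℕ → List (Subset d)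
  classClosures n = filter (λ F → T? (isClassClosure n F)) (allSubsets d)

  subspacePoints : ℕ → Subset d → Subset d
  subspacePoints n F = bigUnion (filter (λ C → T? (cl C =ˢ F)) (smallCircuits n))

  -- rank(l) : the rank of the circuits of the class, i.e. rank C for any circuit
  -- C in the class (all have the same rank, equal to rank (cl C) = rank F)
  subspaceRank : ℕ → Subset d → ℕ
  subspaceRank n F = rank F

  naiveDim : ℕ → ℤ
  naiveDim n = + (n Data.Nat.* d) ℤ.-
    sumℤ (map (λ F → ((+ ∣ subspacePoints n F ∣) ℤ.- (+ subspaceRank n F))
                     ℤ.* ((+ n) ℤ.- (+ subspaceRank n F)))
              (classClosures n))
    where
    sumℤ : List ℤ → ℤ
    sumℤ = foldr ℤ._+_ (+ 0)

splitIndep : (d n q : ℕ) → (Fin q → Subset d) → (Fin q → ℕ) → Indep d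
splitIndep d n q H r X = (∣ X ∣ ≤ᵇ n) ∧ all (λ i → ∣ X ∩ H i ∣ ≤ᵇ r i) (allFin q)

sumFin : (q : ℕ) → (Fin q → ℤ) → ℤ
sumFin q f = foldr ℤ._+_ (+ 0) (map f (allFin q))

-- Under the hypotheses two distinct H i meet in fewer than r j points, so a set with at most r i
-- points in H i and at most one point outside it is independent.  Consequently rank X = r i for
-- every X ⊆ H i with at least r i points, the circuits of size ≤ n are exactly the (r i + 1)-subsets
-- of the H i, each of them has closure H i, and H i is also the union of the circuits of its
-- class.  So the subspaces are precisely H 1, …, H q, with |l| = |H i| and rank l = r i.
module Submission where

open import Defs
open import Data.Nat using (ℕ; suc; _≤_; _+_; _*_; _∸_)
open import Data.Fin using (Fin)
open import Data.Fin.Subset using (Subset; _∩_; ∁; ∣_∣)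
open import Data.Integer as ℤ using (ℤ; +_)
open import Relation.Binary.PropositionalEquality using (_≡_; _≢_)

open import Data.Bool using (Bool; true; false; _∧_; _∨_; not; T)
open import Data.Bool.ListAction using (all)
open import Data.Bool.Properties using (T?; T-≡; T-∧)
open import Data.Empty using (⊥-elim)
open import Data.Fin.Properties using (¬∀⟶∃¬) renaming (_≟_ to _≟ᶠ_)
open import Data.Fin.Subset using (_∪_; _⊆_; _∈_; _∉_; ⁅_⁆; outside; inside)
import Data.Fin.Subset as Subset
open import Data.Fin.Subset.Properties
import Data.Integer.Properties as ℤP
open import Data.List using (List; []; _∷_; map; filter; foldr; allFin)
open import Data.List.Membership.Propositional using (find; lose) renaming (_∈_ to _∈ₗ_)
open import Data.List.Membership.Propositional.Properties
  using (∈-map⁺; ∈-map⁻; ∈-++⁺ˡ; ∈-++⁺ʳ; ∈-filter⁺; ∈-filter⁻; ∈-allFin)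
open import Data.List.Membership.Propositional.Properties.WithK using (unique∧set⇒bag)
open import Data.List.Properties using (map-∘; map-cong)
open import Data.List.Relation.Binary.BagAndSetEquality using (∼bag⇒↭)
open import Data.List.Relation.Binary.Permutation.Propositional using (_↭_; ↭⇒↭ₛ)
import Data.List.Relation.Binary.Permutation.Propositional.Properties as ↭
import Data.List.Relation.Binary.Permutation.Setoid.Properties as ↭ₛ
open import Data.List.Relation.Unary.All using (All)
import Data.List.Relation.Unary.All as All
open import Data.List.Relation.Unary.All.Properties using (all⁺; all⁻)
open import Data.List.Relation.Unary.Any using (here; there)
open import Data.List.Relation.Unary.Any.Properties using (any⁺; any⁻)
import Data.List.Relation.Unary.AllPairs as AllPairs
open import Data.List.Relation.Unary.Unique.Propositional using (Unique)
import Data.List.Relation.Unary.Unique.Propositional.Properties as Unique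
open import Data.Nat using (zero; _<_; z≤n; s≤s; s≤s⁻¹; _≤?_; _⊔_; _≤ᵇ_; _≡ᵇ_)
open import Data.Nat.Properties
open import Data.Product using (∃-syntax; _×_; _,_; proj₁; proj₂)
open import Data.Sum using (inj₁; inj₂)
open import Data.Vec using ([]; _∷_; here; lookup)
open import Data.Vec.Properties using (tabulate-cong; tabulate∘lookup; lookup⇒[]=; []=⇒lookup)
open import Function using (_∘_)
open import Function.Bundles using (_⇔_; mk⇔; Equivalence)
open import Function.Definitions using (Injective)
open import Relation.Nullary using (¬_; yes; no; contradiction)
open import Relation.Binary.PropositionalEquality using (refl; sym; trans; cong; cong₂; subst; setoid; module ≡-Reasoning)

open Equivalence using (to; from)

T-⇔⇒≡ : ∀ {a b} → T a ⇔ T b → a ≡ b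
T-⇔⇒≡ {false} {false} _ = refl
T-⇔⇒≡ {false} {true}  h = ⊥-elim (from h _)
T-⇔⇒≡ {true}  {false} h = ⊥-elim (to h _)
T-⇔⇒≡ {true}  {true}  _ = refl

T-not⇔¬T : ∀ {b} → T (not b) ⇔ (¬ T b)
T-not⇔¬T {false} = mk⇔ (λ _ ()) (λ _ → _)
T-not⇔¬T {true}  = mk⇔ (λ ()) (λ ¬t → ¬t _)

⊆ᵇ⇒⊆ : ∀ {d} {X Y : Subset d} → T (X ⊆ᵇ Y) → X ⊆ Y
⊆ᵇ⇒⊆ {X = []}          {[]}          _ ()
⊆ᵇ⇒⊆ {X = outside ∷ X} {_ ∷ Y}       t = out⊆ (⊆ᵇ⇒⊆ t)
⊆ᵇ⇒⊆ {X = inside ∷ X}  {inside ∷ Y}  t = in⊆in (⊆ᵇ⇒⊆ t)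

⊆⇒⊆ᵇ : ∀ {d} {X Y : Subset d} → X ⊆ Y → T (X ⊆ᵇ Y)
⊆⇒⊆ᵇ {X = []}          {[]}          _ = _
⊆⇒⊆ᵇ {X = outside ∷ X} {_ ∷ Y}       p = ⊆⇒⊆ᵇ (drop-∷-⊆ p)
⊆⇒⊆ᵇ {X = inside ∷ X}  {inside ∷ Y}  p = ⊆⇒⊆ᵇ (drop-∷-⊆ p)
⊆⇒⊆ᵇ {X = inside ∷ X}  {outside ∷ Y} p with () ← p here

=ˢ⇒≡ : ∀ {d} {X Y : Subset d} → T (X =ˢ Y) → X ≡ Y
=ˢ⇒≡ t = let X⊆Y , Y⊆X = to T-∧ t in ⊆-antisym (⊆ᵇ⇒⊆ X⊆Y) (⊆ᵇ⇒⊆ Y⊆X)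

≡⇒=ˢ : ∀ {d} {X Y : Subset d} → X ≡ Y → T (X =ˢ Y)
≡⇒=ˢ {X = X} refl = from (T-∧ {X ⊆ᵇ X}) (X⊆ᵇX , X⊆ᵇX)
  where X⊆ᵇX = ⊆⇒⊆ᵇ {X = X} {X} ⊆-refl

∈-allSubsets : ∀ {d} (X : Subset d) → X ∈ₗ allSubsets d
∈-allSubsets []            = here refl
∈-allSubsets (outside ∷ X) = ∈-++⁺ˡ (∈-map⁺ (outside ∷_) (∈-allSubsets X))
∈-allSubsets {suc d} (inside ∷ X) =
  ∈-++⁺ʳ (map (outside ∷_) (allSubsets d)) (∈-map⁺ (inside ∷_) (∈-allSubsets X))

allSubsets-unique : ∀ d → Unique (allSubsets d)
allSubsets-unique zero    = All.[] AllPairs.∷ AllPairs.[]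
allSubsets-unique (suc d) =
  Unique.++⁺ (Unique.map⁺ ∷-injective (allSubsets-unique d))
             (Unique.map⁺ ∷-injective (allSubsets-unique d)) disjoint
  where
  ∷-injective : ∀ {b} {X Y : Subset d} → b ∷ X ≡ b ∷ Y → X ≡ Y
  ∷-injective refl = refl
  disjoint : ∀ {X} → ¬ (X ∈ₗ map (outside ∷_) (allSubsets d) × X ∈ₗ map (inside ∷_) (allSubsets d))
  disjoint (X∈₁ , X∈₂) with ∈-map⁻ (outside ∷_) X∈₁ | ∈-map⁻ (inside ∷_) X∈₂
  ... | _ , _ , refl | _ , _ , ()

∈-bigUnion⁺ : ∀ {d} {Xs : List (Subset d)} {X x} → X ∈ₗ Xs → x ∈ X → x ∈ bigUnion Xs
∈-bigUnion⁺ (here refl) x∈X = x∈p∪q⁺ (inj₁ x∈X)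
∈-bigUnion⁺ (there X∈)  x∈X = x∈p∪q⁺ (inj₂ (∈-bigUnion⁺ X∈ x∈X))

∈-bigUnion⁻ : ∀ {d} (Xs : List (Subset d)) {x} → x ∈ bigUnion Xs → ∃[ X ] X ∈ₗ Xs × x ∈ X
∈-bigUnion⁻ []       x∈ = ⊥-elim (∉⊥ x∈)
∈-bigUnion⁻ (X ∷ Xs) x∈ with x∈p∪q⁻ X (bigUnion Xs) x∈
... | inj₁ x∈X = X , here refl , x∈X
... | inj₂ x∈⋃ with Y , Y∈ , x∈Y ← ∈-bigUnion⁻ Xs x∈⋃ = Y , there Y∈ , x∈Y

∣p∪q∣≤∣p∣+∣q∣ : ∀ {d} (p q : Subset d) → ∣ p ∪ q ∣ ≤ ∣ p ∣ + ∣ q ∣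
∣p∪q∣≤∣p∣+∣q∣ []            []            = z≤n
∣p∪q∣≤∣p∣+∣q∣ (outside ∷ p) (outside ∷ q) = ∣p∪q∣≤∣p∣+∣q∣ p q
∣p∪q∣≤∣p∣+∣q∣ (outside ∷ p) (inside ∷ q)  rewrite +-suc ∣ p ∣ ∣ q ∣ = s≤s (∣p∪q∣≤∣p∣+∣q∣ p q)
∣p∪q∣≤∣p∣+∣q∣ (inside ∷ p)  (outside ∷ q) = s≤s (∣p∪q∣≤∣p∣+∣q∣ p q)
∣p∪q∣≤∣p∣+∣q∣ (inside ∷ p)  (inside ∷ q)  =
  s≤s (≤-trans (∣p∪q∣≤∣p∣+∣q∣ p q) (+-monoʳ-≤ ∣ p ∣ (n≤1+n ∣ q ∣)))

∪-monoˡ-⊆ : ∀ {d} {p q r : Subset d} → p ⊆ q → p ∪ r ⊆ q ∪ r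
∪-monoˡ-⊆ {p = p} {r = r} p⊆q x∈ with x∈p∪q⁻ p r x∈
... | inj₁ x∈p = x∈p∪q⁺ (inj₁ (p⊆q x∈p))
... | inj₂ x∈r = x∈p∪q⁺ (inj₂ x∈r)

p⊆q⇒∣p∩q∣≡∣p∣ : ∀ {d} {p q : Subset d} → p ⊆ q → ∣ p ∩ q ∣ ≡ ∣ p ∣
p⊆q⇒∣p∩q∣≡∣p∣ {p = p} {q} p⊆q =
  ≤-antisym (∣p∩q∣≤∣p∣ p q) (p⊆q⇒∣p∣≤∣q∣ (λ x∈p → x∈p∩q⁺ (x∈p , p⊆q x∈p)))

p⊆q∧∣q∣≤∣p∣⇒p≡q : ∀ {d} {p q : Subset d} → p ⊆ q → ∣ q ∣ ≤ ∣ p ∣ → p ≡ q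
p⊆q∧∣q∣≤∣p∣⇒p≡q {p = []}          {[]}          _   _ = refl
p⊆q∧∣q∣≤∣p∣⇒p≡q {p = outside ∷ p} {outside ∷ q} p⊆q le =
  cong (outside ∷_) (p⊆q∧∣q∣≤∣p∣⇒p≡q (drop-∷-⊆ p⊆q) le)
p⊆q∧∣q∣≤∣p∣⇒p≡q {p = outside ∷ p} {inside ∷ q}  p⊆q le =
  contradiction le (<⇒≱ (s≤s (p⊆q⇒∣p∣≤∣q∣ (drop-∷-⊆ p⊆q))))
p⊆q∧∣q∣≤∣p∣⇒p≡q {p = inside ∷ p}  {inside ∷ q}  p⊆q le =
  cong (inside ∷_) (p⊆q∧∣q∣≤∣p∣⇒p≡q (drop-∷-⊆ p⊆q) (s≤s⁻¹ le))
p⊆q∧∣q∣≤∣p∣⇒p≡q {p = inside ∷ p}  {outside ∷ q} p⊆q le with () ← p⊆q here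

⊆-interpolate : ∀ {d} {p q : Subset d} k → p ⊆ q → ∣ p ∣ ≤ k → k ≤ ∣ q ∣ →
                ∃[ Y ] p ⊆ Y × Y ⊆ q × ∣ Y ∣ ≡ k
⊆-interpolate {p = []} {[]} zero    _ _ _  = [] , (λ ()) , (λ ()) , refl
⊆-interpolate {p = []} {[]} (suc k) _ _ ()
⊆-interpolate {p = inside ∷ p} {outside ∷ q} _ p⊆q _ _ with () ← p⊆q here
⊆-interpolate {p = outside ∷ p} {outside ∷ q} k p⊆q p≤k k≤q
  with Y , p⊆Y , Y⊆q , ∣Y∣ ← ⊆-interpolate k (drop-∷-⊆ p⊆q) p≤k k≤q
  = outside ∷ Y , out⊆ p⊆Y , out⊆ Y⊆q , ∣Y∣
⊆-interpolate {p = inside ∷ p} {inside ∷ q} zero _ () _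
⊆-interpolate {p = inside ∷ p} {inside ∷ q} (suc k) p⊆q p≤k k≤q
  with Y , p⊆Y , Y⊆q , ∣Y∣ ← ⊆-interpolate k (drop-∷-⊆ p⊆q) (s≤s⁻¹ p≤k) (s≤s⁻¹ k≤q)
  = inside ∷ Y , in⊆in p⊆Y , in⊆in Y⊆q , cong suc ∣Y∣
⊆-interpolate {p = outside ∷ p} {inside ∷ q} k p⊆q p≤k k≤q with k ≤? ∣ q ∣
... | yes k≤q′
  with Y , p⊆Y , Y⊆q , ∣Y∣ ← ⊆-interpolate k (drop-∷-⊆ p⊆q) p≤k k≤q′
  = outside ∷ Y , out⊆ p⊆Y , out⊆ Y⊆q , ∣Y∣
... | no k≰q′ = inside ∷ q , p⊆q , ⊆-refl , ≤-antisym (≰⇒> k≰q′) k≤q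

⊆-ofSize : ∀ {d} {q : Subset d} k → k ≤ ∣ q ∣ → ∃[ Y ] Y ⊆ q × ∣ Y ∣ ≡ k
⊆-ofSize {d} k k≤q =
  let Y , _ , Y⊆q , ∣Y∣ = ⊆-interpolate k (⊆-min _) (subst (_≤ k) (sym (∣⊥∣≡0 d)) z≤n) k≤q
  in Y , Y⊆q , ∣Y∣

sumℤ : List ℤ → ℤ
sumℤ = foldr ℤ._+_ (+ 0)

sumℤ-↭ : ∀ {xs ys} → xs ↭ ys → sumℤ xs ≡ sumℤ ys
sumℤ-↭ xs↭ys = ↭ₛ.foldr-commMonoid (setoid ℤ) ℤP.+-0-isCommutativeMonoid (↭⇒↭ₛ xs↭ys)

[+m-+k]*[+n-+k]≡+[[n∸k]*[m∸k]] : ∀ {m n k} → k ≤ m → k ≤ n →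
  ((+ m) ℤ.- (+ k)) ℤ.* ((+ n) ℤ.- (+ k)) ≡ + ((n ∸ k) * (m ∸ k))
[+m-+k]*[+n-+k]≡+[[n∸k]*[m∸k]] {m} {n} {k} k≤m k≤n = begin
  ((+ m) ℤ.- (+ k)) ℤ.* ((+ n) ℤ.- (+ k)) ≡⟨ cong₂ ℤ._*_ (difference k≤m) (difference k≤n) ⟩
  + (m ∸ k) ℤ.* + (n ∸ k)                  ≡⟨ ℤP.pos-* (m ∸ k) (n ∸ k) ⟨
  + ((m ∸ k) * (n ∸ k))                    ≡⟨ cong +_ (*-comm (m ∸ k) (n ∸ k)) ⟩
  + ((n ∸ k) * (m ∸ k))                    ∎
  where
  open ≡-Reasoning
  difference : ∀ {a} → k ≤ a → (+ a) ℤ.- (+ k) ≡ + (a ∸ k)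
  difference {a} k≤a = trans (ℤP.[+m]-[+n]≡m⊖n a k) (ℤP.⊖-≥ k≤a)

-- Matroid notions, for an arbitrary independence test

module MatroidProperties {d : ℕ} (ind : Indep d) where
  open MatroidNotions ind

  private
    indepIn : Subset d → Subset d → Bool
    indepIn X Y = (Y ⊆ᵇ X) ∧ ind Y

  rank-lub : ∀ {X k} → (∀ {Y} → Y ⊆ X → T (ind Y) → ∣ Y ∣ ≤ k) → rank X ≤ k
  rank-lub {X} {k} bound = foldr-lub (map ∣_∣ (filter (T? ∘ indepIn X) (allSubsets d))) bounded
    where
    foldr-lub : ∀ ms → All (_≤ k) ms → foldr _⊔_ 0 ms ≤ k
    foldr-lub []       All.[]         = z≤n
    foldr-lub (m ∷ ms) (m≤k All.∷ ms≤k) = ⊔-lub m≤k (foldr-lub ms ms≤k)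
    bounded : All (_≤ k) (map ∣_∣ (filter (T? ∘ indepIn X) (allSubsets d)))
    bounded = All.tabulate λ m∈ → case (∈-map⁻ ∣_∣ m∈)
      where
      case : ∀ {m} → ∃[ Y ] Y ∈ₗ filter (T? ∘ indepIn X) (allSubsets d) × m ≡ ∣ Y ∣ → m ≤ k
      case (Y , Y∈ , refl) =
        let Y⊆X , indY = to T-∧ (proj₂ (∈-filter⁻ (T? ∘ indepIn X) {xs = allSubsets d} Y∈))
        in bound (⊆ᵇ⇒⊆ Y⊆X) indY

  ∣indep∣≤rank : ∀ {X Y} → Y ⊆ X → T (ind Y) → ∣ Y ∣ ≤ rank X
  ∣indep∣≤rank {X} {Y} Y⊆X indY = foldr-ub (∈-map⁺ ∣_∣ Y∈)
    where
    Y∈ : Y ∈ₗ filter (T? ∘ indepIn X) (allSubsets d)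
    Y∈ = ∈-filter⁺ (T? ∘ indepIn X) (∈-allSubsets Y) (from T-∧ (⊆⇒⊆ᵇ Y⊆X , indY))
    foldr-ub : ∀ {m ms} → m ∈ₗ ms → m ≤ foldr _⊔_ 0 ms
    foldr-ub {ms = m′ ∷ _}  (here refl) = m≤m⊔n m′ _
    foldr-ub {ms = m′ ∷ ms} (there m∈)  = ≤-trans (foldr-ub m∈) (m≤n⊔m m′ _)

  cl-≡ : ∀ {X F} → (∀ x → rank (X ∪ ⁅ x ⁆) ≡ rank X ⇔ x ∈ F) → cl X ≡ F
  cl-≡ {X} {F} spans = trans (tabulate-cong pointwise) (tabulate∘lookup F)
    where
    pointwise : ∀ x → (rank (X ∪ ⁅ x ⁆) ≡ᵇ rank X) ≡ lookup F x
    pointwise x = T-⇔⇒≡ (mk⇔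
      (λ t → from T-≡ ([]=⇒lookup (to (spans x) (≡ᵇ⇒≡ _ _ t))))
      (λ t → ≡⇒≡ᵇ _ _ (from (spans x) (lookup⇒[]= x F (to T-≡ t)))))

  private
    properSubsetIndep : Subset d → Subset d → Bool
    properSubsetIndep C Y = not ((Y ⊆ᵇ C) ∧ not (Y =ˢ C)) ∨ ind Y

    implies⁺ : ∀ {a b c} → (T a → ¬ T b → T c) → T (not (a ∧ not b) ∨ c)
    implies⁺ {false}         _ = _
    implies⁺ {true}  {true}  _ = _
    implies⁺ {true}  {false} h = h _ λ ()

    implies⁻ : ∀ {a b c} → T (not (a ∧ not b) ∨ c) → T a → ¬ T c → T b
    implies⁻ {true} {true}  _ _ _   = _
    implies⁻ {true} {false} t _ ¬tc = ¬tc t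

  isCircuit⁺ : ∀ {C} → ¬ T (ind C) → (∀ {Y} → Y ⊆ C → Y ≢ C → T (ind Y)) → T (isCircuit C)
  isCircuit⁺ {C} depC minimal =
    from T-∧ (from T-not⇔¬T depC , all⁻ (properSubsetIndep C) (All.tabulate proper))
    where
    proper : ∀ {Y} → Y ∈ₗ allSubsets d → T (properSubsetIndep C Y)
    proper {Y} _ = implies⁺ λ Y⊆C Y≠C → minimal (⊆ᵇ⇒⊆ Y⊆C) (λ Y≡C → Y≠C (≡⇒=ˢ {X = Y} Y≡C))

  isCircuit-dependent : ∀ {C} → T (isCircuit C) → ¬ T (ind C)
  isCircuit-dependent {C} t = to T-not⇔¬T (proj₁ (to (T-∧ {not (ind C)}) t))

  isCircuit-minimal : ∀ {C Y} → T (isCircuit C) → Y ⊆ C → ¬ T (ind Y) → Y ≡ C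
  isCircuit-minimal {C} {Y} t Y⊆C depY =
    =ˢ⇒≡ (implies⁻ (All.lookup subsetsIndep (∈-allSubsets Y)) (⊆⇒⊆ᵇ Y⊆C) depY)
    where
    subsetsIndep : All (T ∘ properSubsetIndep C) (allSubsets d)
    subsetsIndep = all⁺ (properSubsetIndep C) (allSubsets d) (proj₂ (to (T-∧ {not (ind C)}) t))

  module _ (n : ℕ) where

    ∈-smallCircuits⁺ : ∀ {C} → T (isCircuit C) → ∣ C ∣ ≤ n → C ∈ₗ smallCircuits n
    ∈-smallCircuits⁺ {C} circ C≤n =
      ∈-filter⁺ (λ C → T? (isCircuit C ∧ (∣ C ∣ ≤ᵇ n))) (∈-allSubsets C) (from T-∧ (circ , ≤⇒≤ᵇ C≤n))

    ∈-smallCircuits⁻ : ∀ {C} → C ∈ₗ smallCircuits n → T (isCircuit C) × ∣ C ∣ ≤ n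
    ∈-smallCircuits⁻ {C} C∈ =
      let circ , C≤n = to T-∧ (proj₂ (∈-filter⁻ (λ C → T? (isCircuit C ∧ (∣ C ∣ ≤ᵇ n))) {xs = allSubsets d} C∈))
      in circ , ≤ᵇ⇒≤ _ _ C≤n

    ∈-classClosures⁺ : ∀ {C F} → C ∈ₗ smallCircuits n → cl C ≡ F → F ∈ₗ classClosures n
    ∈-classClosures⁺ {C} {F} C∈ clC≡F = ∈-filter⁺ (T? ∘ isClassClosure n) (∈-allSubsets F)
      (any⁺ (λ C → cl C =ˢ F) (lose C∈ (≡⇒=ˢ clC≡F)))

    ∈-classClosures⁻ : ∀ {F} → F ∈ₗ classClosures n → ∃[ C ] C ∈ₗ smallCircuits n × cl C ≡ F
    ∈-classClosures⁻ {F} F∈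
      with C , C∈ , clC=F ← find (any⁻ (λ C → cl C =ˢ F) (smallCircuits n)
                                   (proj₂ (∈-filter⁻ (T? ∘ isClassClosure n) {xs = allSubsets d} F∈)))
      = C , C∈ , =ˢ⇒≡ clC=F

    ∈-subspacePoints⁺ : ∀ {C F x} → C ∈ₗ smallCircuits n → cl C ≡ F → x ∈ C → x ∈ subspacePoints n F
    ∈-subspacePoints⁺ {F = F} C∈ clC≡F x∈C =
      ∈-bigUnion⁺ (∈-filter⁺ (λ C → T? (cl C =ˢ F)) C∈ (≡⇒=ˢ clC≡F)) x∈C

    ∈-subspacePoints⁻ : ∀ {F x} → x ∈ subspacePoints n F →
                        ∃[ C ] C ∈ₗ smallCircuits n × cl C ≡ F × x ∈ C
    ∈-subspacePoints⁻ {F} x∈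
      with C , C∈ , x∈C ← ∈-bigUnion⁻ (filter (λ C → T? (cl C =ˢ F)) (smallCircuits n)) x∈
      with C∈′ , clC=F ← ∈-filter⁻ (λ C → T? (cl C =ˢ F)) {xs = smallCircuits n} C∈
      = C , C∈′ , =ˢ⇒≡ clC=F , x∈C

    subspaceTerm : Subset d → ℤ
    subspaceTerm F = ((+ ∣ subspacePoints n F ∣) ℤ.- (+ subspaceRank n F)) ℤ.* ((+ n) ℤ.- (+ subspaceRank n F))

    subspaceTerm-≡ : ∀ {F a b} → ∣ subspacePoints n F ∣ ≡ a → subspaceRank n F ≡ b → b ≤ a → b ≤ n →
                     subspaceTerm F ≡ + ((n ∸ b) * (a ∸ b))
    -- The implicit arguments are given because inferring them would make Agda normalise subspaceTerm F.
    subspaceTerm-≡ {F} refl refl = [+m-+k]*[+n-+k]≡+[[n∸k]*[m∸k]] {∣ subspacePoints n F ∣} {n} {subspaceRank n F}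

    naiveDim-reindex : ∀ {q} (F : Fin q → Subset d) → Injective _≡_ _≡_ F →
      (∀ {G} → G ∈ₗ classClosures n → ∃[ i ] G ≡ F i) → (∀ i → F i ∈ₗ classClosures n) →
      naiveDim n ≡ (+ (n * d)) ℤ.- sumFin q (subspaceTerm ∘ F)
    naiveDim-reindex {q} F F-injective closures⊆F F⊆closures = cong (λ s → (+ (n * d)) ℤ.- s) (begin
      sumℤ (map subspaceTerm (classClosures n))        ≡⟨ sumℤ-↭ (↭.map⁺ subspaceTerm closures↭F) ⟩
      sumℤ (map subspaceTerm (map F (allFin q)))        ≡⟨ cong sumℤ (map-∘ (allFin q)) ⟨
      sumℤ (map (subspaceTerm ∘ F) (allFin q))          ∎)
      where
      open ≡-Reasoning
      closures↭F : classClosures n ↭ map F (allFin q)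
      closures↭F = ∼bag⇒↭ (unique∧set⇒bag
        (Unique.filter⁺ (T? ∘ isClassClosure n) (allSubsets-unique d))
        (Unique.map⁺ F-injective (Unique.allFin⁺ q))
        (mk⇔ (λ G∈ → let i , G≡Fi = closures⊆F G∈ in subst (_∈ₗ map F (allFin q)) (sym G≡Fi) (∈-map⁺ F (∈-allFin i)))
             (λ G∈ → let i , _ , G≡Fi = ∈-map⁻ F G∈ in subst (_∈ₗ classClosures n) (sym G≡Fi) (F⊆closures i))))

-- The elementary split matroid

module SplitMatroid {d n q : ℕ} (H : Fin q → Subset d) (r : Fin q → ℕ)
  (r<n : ∀ i → r i < n) (r<∣H∣ : ∀ i → r i < ∣ H i ∣)
  (∣H∩H∣<r : ∀ {i j} → i ≢ j → ∣ H i ∩ H j ∣ < r j) where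

  ind : Indep d
  ind = splitIndep d n q H r

  open MatroidNotions ind
  open MatroidProperties ind

  indep⁺ : ∀ {X} → ∣ X ∣ ≤ n → (∀ i → ∣ X ∩ H i ∣ ≤ r i) → T (ind X)
  indep⁺ {X} X≤n bounded = from (T-∧ {∣ X ∣ ≤ᵇ n})
    (≤⇒≤ᵇ X≤n , all⁻ (λ i → ∣ X ∩ H i ∣ ≤ᵇ r i) {xs = allFin q} (All.tabulate λ {i} _ → ≤⇒≤ᵇ (bounded i)))

  indep⁻ : ∀ {X} → T (ind X) → ∀ i → ∣ X ∩ H i ∣ ≤ r i
  indep⁻ {X} t i = ≤ᵇ⇒≤ _ _ (All.lookup (all⁺ (λ j → ∣ X ∩ H j ∣ ≤ᵇ r j) (allFin q) bounded) (∈-allFin i))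
    where
    bounded : T (all (λ j → ∣ X ∩ H j ∣ ≤ᵇ r j) (allFin q))
    bounded = proj₂ (to (T-∧ {∣ X ∣ ≤ᵇ n}) t)

  dependent⇒overfull : ∀ {X} → ∣ X ∣ ≤ n → ¬ T (ind X) → ∃[ i ] r i < ∣ X ∩ H i ∣
  dependent⇒overfull {X} X≤n depX =
    let i , X∩Hi≰r = ¬∀⟶∃¬ q (λ i → ∣ X ∩ H i ∣ ≤ r i) (λ i → _ ≤? _) (depX ∘ indep⁺ {X} X≤n)
    in i , ≰⇒> X∩Hi≰r

  indep-⊆H∪E : ∀ i {Y E} → Y ⊆ H i ∪ E → ∣ E ∣ ≤ 1 → ∣ Y ∣ ≤ n → ∣ Y ∩ H i ∣ ≤ r i → T (ind Y)
  indep-⊆H∪E i {Y} {E} Y⊆Hi∪E E≤1 Y≤n Y∩Hi≤r = indep⁺ {Y} Y≤n bounded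
    where
    bounded : ∀ j → ∣ Y ∩ H j ∣ ≤ r j
    bounded j with i ≟ᶠ j
    ... | yes refl = Y∩Hi≤r
    ... | no i≢j = begin
      ∣ Y ∩ H j ∣             ≤⟨ p⊆q⇒∣p∣≤∣q∣ Y∩Hj⊆ ⟩
      ∣ (H i ∩ H j) ∪ E ∣     ≤⟨ ∣p∪q∣≤∣p∣+∣q∣ (H i ∩ H j) E ⟩
      (∣ H i ∩ H j ∣) + ∣ E ∣ ≤⟨ +-monoʳ-≤ ∣ H i ∩ H j ∣ E≤1 ⟩
      (∣ H i ∩ H j ∣) + 1     ≡⟨ +-comm ∣ H i ∩ H j ∣ 1 ⟩
      suc ∣ H i ∩ H j ∣       ≤⟨ ∣H∩H∣<r i≢j ⟩
      r j                     ∎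
      where
      open ≤-Reasoning
      Y∩Hj⊆ : Y ∩ H j ⊆ (H i ∩ H j) ∪ E
      Y∩Hj⊆ x∈ with x∈Y , x∈Hj ← x∈p∩q⁻ Y (H j) x∈ with x∈p∪q⁻ (H i) E (Y⊆Hi∪E x∈Y)
      ... | inj₁ x∈Hi = x∈p∪q⁺ (inj₁ (x∈p∩q⁺ (x∈Hi , x∈Hj)))
      ... | inj₂ x∈E  = x∈p∪q⁺ (inj₂ x∈E)

  indep-⊆H : ∀ i {Y} → Y ⊆ H i → ∣ Y ∣ ≤ r i → T (ind Y)
  indep-⊆H i {Y} Y⊆Hi Y≤r =
    indep-⊆H∪E i {E = Subset.⊥} (λ x∈Y → x∈p∪q⁺ (inj₁ (Y⊆Hi x∈Y))) (≤-trans (≤-reflexive (∣⊥∣≡0 d)) z≤n)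
      (≤-trans Y≤r (<⇒≤ (r<n i))) (≤-trans (∣p∩q∣≤∣p∣ Y (H i)) Y≤r)

  rank-⊆H : ∀ i {X} → X ⊆ H i → r i ≤ ∣ X ∣ → rank X ≡ r i
  rank-⊆H i {X} X⊆Hi r≤X = ≤-antisym rank≤r r≤rank
    where
    rank≤r : rank X ≤ r i
    rank≤r = rank-lub λ {Y} Y⊆X indY → subst (_≤ r i) (p⊆q⇒∣p∩q∣≡∣p∣ (⊆-trans Y⊆X X⊆Hi)) (indep⁻ {Y} indY i)
    r≤rank : r i ≤ rank X
    r≤rank = let Y , Y⊆X , ∣Y∣ = ⊆-ofSize (r i) r≤X in
      subst (_≤ rank X) ∣Y∣ (∣indep∣≤rank Y⊆X (indep-⊆H i (⊆-trans Y⊆X X⊆Hi) (≤-reflexive ∣Y∣)))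

  r<rank-∪-outside : ∀ i {X x} → X ⊆ H i → r i ≤ ∣ X ∣ → x ∉ H i → r i < rank (X ∪ ⁅ x ⁆)
  r<rank-∪-outside i {X} {x} X⊆Hi r≤X x∉Hi with Y , Y⊆X , ∣Y∣ ← ⊆-ofSize (r i) r≤X = begin-strict
    r i               ≡⟨ ∣Y∣ ⟨
    ∣ Y ∣             <⟨ p⊂q⇒∣p∣<∣q∣ (p⊆p∪q ⁅ x ⁆ , x , x∈p∪q⁺ (inj₂ (x∈⁅x⁆ x)) , x∉Hi ∘ X⊆Hi ∘ Y⊆X) ⟩
    ∣ Y ∪ ⁅ x ⁆ ∣     ≤⟨ ∣indep∣≤rank (∪-monoˡ-⊆ Y⊆X) indY∪x ⟩
    rank (X ∪ ⁅ x ⁆)  ∎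
    where
    open ≤-Reasoning
    Y∪x∩Hi⊆Y : (Y ∪ ⁅ x ⁆) ∩ H i ⊆ Y
    Y∪x∩Hi⊆Y y∈ with y∈Y∪x , y∈Hi ← x∈p∩q⁻ (Y ∪ ⁅ x ⁆) (H i) y∈ with x∈p∪q⁻ Y ⁅ x ⁆ y∈Y∪x
    ... | inj₁ y∈Y = y∈Y
    ... | inj₂ y∈x = contradiction (subst (_∈ H i) (x∈⁅y⁆⇒x≡y x y∈x) y∈Hi) x∉Hi
    ∣Y∪x∣≤n : ∣ Y ∪ ⁅ x ⁆ ∣ ≤ n
    ∣Y∪x∣≤n = begin
      ∣ Y ∪ ⁅ x ⁆ ∣     ≤⟨ ∣p∪q∣≤∣p∣+∣q∣ Y ⁅ x ⁆ ⟩
      (∣ Y ∣) + ∣ ⁅ x ⁆ ∣ ≡⟨ cong₂ _+_ ∣Y∣ (∣⁅x⁆∣≡1 x) ⟩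
      r i + 1           ≡⟨ +-comm (r i) 1 ⟩
      suc (r i)         ≤⟨ r<n i ⟩
      n                 ∎
    indY∪x : T (ind (Y ∪ ⁅ x ⁆))
    indY∪x = indep-⊆H∪E i (∪-monoˡ-⊆ (X⊆Hi ∘ Y⊆X)) (≤-reflexive (∣⁅x⁆∣≡1 x)) ∣Y∪x∣≤n
      (≤-trans (p⊆q⇒∣p∣≤∣q∣ Y∪x∩Hi⊆Y) (≤-reflexive ∣Y∣))

  cl-⊆H : ∀ i {X} → X ⊆ H i → r i ≤ ∣ X ∣ → cl X ≡ H i
  cl-⊆H i {X} X⊆Hi r≤X = cl-≡ λ x → mk⇔ (rank-stable⇒∈ x) (∈⇒rank-stable x)
    where
    rankX≡r : rank X ≡ r i
    rankX≡r = rank-⊆H i X⊆Hi r≤X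
    rank-stable⇒∈ : ∀ x → rank (X ∪ ⁅ x ⁆) ≡ rank X → x ∈ H i
    rank-stable⇒∈ x stable with x ∈? H i
    ... | yes x∈Hi = x∈Hi
    ... | no  x∉Hi = contradiction (trans stable rankX≡r) (>⇒≢ (r<rank-∪-outside i X⊆Hi r≤X x∉Hi))
    ∈⇒rank-stable : ∀ x → x ∈ H i → rank (X ∪ ⁅ x ⁆) ≡ rank X
    ∈⇒rank-stable x x∈Hi = trans (rank-⊆H i X∪x⊆Hi (≤-trans r≤X (∣p∣≤∣p∪q∣ X ⁅ x ⁆))) (sym rankX≡r)
      where
      X∪x⊆Hi : X ∪ ⁅ x ⁆ ⊆ H i
      X∪x⊆Hi y∈ with x∈p∪q⁻ X ⁅ x ⁆ y∈
      ... | inj₁ y∈X = X⊆Hi y∈X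
      ... | inj₂ y∈x = subst (_∈ H i) (sym (x∈⁅y⁆⇒x≡y x y∈x)) x∈Hi

  dependent-⊆H : ∀ i {Y} → Y ⊆ H i → ∣ Y ∣ ≡ suc (r i) → ¬ T (ind Y)
  dependent-⊆H i {Y} Y⊆Hi ∣Y∣ indY =
    <⇒≱ (≤-reflexive (sym (trans (p⊆q⇒∣p∩q∣≡∣p∣ Y⊆Hi) ∣Y∣))) (indep⁻ {Y} indY i)

  cl-circuit : ∀ i {C} → C ⊆ H i → ∣ C ∣ ≡ suc (r i) → cl C ≡ H i
  cl-circuit i C⊆Hi ∣C∣ = cl-⊆H i C⊆Hi (subst (r i ≤_) (sym ∣C∣) (n≤1+n (r i)))

  smallCircuit⁺ : ∀ i {C} → C ⊆ H i → ∣ C ∣ ≡ suc (r i) → C ∈ₗ smallCircuits n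
  smallCircuit⁺ i {C} C⊆Hi ∣C∣ =
    ∈-smallCircuits⁺ n (isCircuit⁺ (dependent-⊆H i C⊆Hi ∣C∣) indepBelow) (subst (_≤ n) (sym ∣C∣) (r<n i))
    where
    indepBelow : ∀ {Y} → Y ⊆ C → Y ≢ C → T (ind Y)
    indepBelow {Y} Y⊆C Y≢C = indep-⊆H i (⊆-trans Y⊆C C⊆Hi) (s≤s⁻¹ (subst (∣ Y ∣ <_) ∣C∣ ∣Y∣<∣C∣))
      where
      ∣Y∣<∣C∣ : ∣ Y ∣ < ∣ C ∣
      ∣Y∣<∣C∣ = ≰⇒> (Y≢C ∘ p⊆q∧∣q∣≤∣p∣⇒p≡q Y⊆C)

  smallCircuit⁻ : ∀ {C} → C ∈ₗ smallCircuits n → ∃[ i ] C ⊆ H i × ∣ C ∣ ≡ suc (r i)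
  smallCircuit⁻ {C} C∈ =
    let circ , C≤n       = ∈-smallCircuits⁻ n C∈
        i , r<∣C∩Hi∣     = dependent⇒overfull {C} C≤n (isCircuit-dependent circ)
        Y , Y⊆C∩Hi , ∣Y∣ = ⊆-ofSize (suc (r i)) r<∣C∩Hi∣
        Y⊆C : Y ⊆ C
        Y⊆C y∈ = proj₁ (x∈p∩q⁻ C (H i) (Y⊆C∩Hi y∈))
        Y⊆Hi : Y ⊆ H i
        Y⊆Hi y∈ = proj₂ (x∈p∩q⁻ C (H i) (Y⊆C∩Hi y∈))
        Y≡C = isCircuit-minimal circ Y⊆C (dependent-⊆H i Y⊆Hi ∣Y∣)
    in i , subst (_⊆ H i) Y≡C Y⊆Hi , subst (λ Z → ∣ Z ∣ ≡ suc (r i)) Y≡C ∣Y∣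

  classClosure⁻ : ∀ {F} → F ∈ₗ classClosures n → ∃[ i ] F ≡ H i
  classClosure⁻ F∈ =
    let C , C∈ , clC≡F   = ∈-classClosures⁻ n F∈
        i , C⊆Hi , ∣C∣   = smallCircuit⁻ C∈
    in i , trans (sym clC≡F) (cl-circuit i C⊆Hi ∣C∣)

  classClosure⁺ : ∀ i → H i ∈ₗ classClosures n
  classClosure⁺ i =
    let C , C⊆Hi , ∣C∣ = ⊆-ofSize (suc (r i)) (r<∣H∣ i)
    in ∈-classClosures⁺ n (smallCircuit⁺ i C⊆Hi ∣C∣) (cl-circuit i C⊆Hi ∣C∣)

  subspacePoints-H : ∀ i → subspacePoints n (H i) ≡ H i
  subspacePoints-H i = ⊆-antisym points⊆Hi Hi⊆points
    where
    points⊆Hi : subspacePoints n (H i) ⊆ H i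
    points⊆Hi {x} x∈ =
      let C , C∈ , clC≡Hi , x∈C = ∈-subspacePoints⁻ n {H i} x∈
          j , C⊆Hj , ∣C∣        = smallCircuit⁻ C∈
      in subst (x ∈_) (trans (sym (cl-circuit j C⊆Hj ∣C∣)) clC≡Hi) (C⊆Hj x∈C)
    ∣⁅x⁆∣≤1+r : ∀ x → ∣ ⁅ x ⁆ ∣ ≤ suc (r i)
    ∣⁅x⁆∣≤1+r x = subst (_≤ suc (r i)) (sym (∣⁅x⁆∣≡1 x)) (s≤s z≤n)
    ⁅x⁆⊆Hi : ∀ {x} → x ∈ H i → ⁅ x ⁆ ⊆ H i
    ⁅x⁆⊆Hi {x} x∈Hi y∈ = subst (_∈ H i) (sym (x∈⁅y⁆⇒x≡y x y∈)) x∈Hi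
    Hi⊆points : H i ⊆ subspacePoints n (H i)
    Hi⊆points {x} x∈Hi =
      let C , x⊆C , C⊆Hi , ∣C∣ = ⊆-interpolate (suc (r i)) (⁅x⁆⊆Hi x∈Hi) (∣⁅x⁆∣≤1+r x) (r<∣H∣ i)
      in ∈-subspacePoints⁺ n {F = H i} (smallCircuit⁺ i C⊆Hi ∣C∣) (cl-circuit i C⊆Hi ∣C∣) (x⊆C (x∈⁅x⁆ x))

  H-injective : Injective _≡_ _≡_ H
  H-injective {i} {j} Hi≡Hj with i ≟ᶠ j
  ... | yes i≡j = i≡j
  ... | no  i≢j = contradiction (∣H∩H∣<r i≢j) (<⇒≱ (subst (r j <_) ∣Hj∣≡∣Hi∩Hj∣ (r<∣H∣ j)) ∘ <⇒≤)
    where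
    ∣Hj∣≡∣Hi∩Hj∣ : ∣ H j ∣ ≡ ∣ H i ∩ H j ∣
    ∣Hj∣≡∣Hi∩Hj∣ = cong ∣_∣ (trans (sym (∩-idem (H j))) (cong (_∩ H j) (sym Hi≡Hj)))

  subspaceTerm-H : ∀ i → subspaceTerm n (H i) ≡ + ((n ∸ r i) * (∣ H i ∣ ∸ r i))
  subspaceTerm-H i =
    subspaceTerm-≡ n {H i} (cong ∣_∣ (subspacePoints-H i)) (rank-⊆H i {H i} ⊆-refl r≤∣Hi∣) r≤∣Hi∣ (<⇒≤ (r<n i))
    where
    r≤∣Hi∣ : r i ≤ ∣ H i ∣
    r≤∣Hi∣ = <⇒≤ (r<∣H∣ i)

  naiveDim-split : naiveDim n ≡ (+ (n * d)) ℤ.- sumFin q (λ i → + ((n ∸ r i) * (∣ H i ∣ ∸ r i)))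
  naiveDim-split = trans (naiveDim-reindex n H H-injective classClosure⁻ classClosure⁺)
    (cong (λ s → (+ (n * d)) ℤ.- sumℤ s) (map-cong subspaceTerm-H (allFin q)))

a+n≤b+c∧b<n⇒a<c : ∀ {a b c n} → a + n ≤ b + c → b < n → a < c
a+n≤b+c∧b<n⇒a<c {a} {b} {c} {n} a+n≤b+c b<n = +-cancelʳ-< n a c (begin-strict
  a + n ≤⟨ a+n≤b+c ⟩
  b + c <⟨ +-monoˡ-< c b<n ⟩
  n + c ≡⟨ +-comm n c ⟩
  c + n ∎)
  where open ≤-Reasoning

lemma3p4 : (d n q : ℕ) → 1 ≤ n → n ≤ d →
    (H : Fin q → Subset d) → (r : Fin q → ℕ) →
    (∀ i → 1 ≤ r i) →
    (∀ i j → i ≢ j → ∣ H i ∩ H j ∣ + n ≤ r i + r j) →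
    (∀ i → n ∸ r i ≤ ∣ ∁ (H i) ∣) →
    (∀ i → r i ≤ n ∸ 1) →
    (∀ i → r i + 1 ≤ ∣ H i ∣) →
    MatroidNotions.naiveDim (splitIndep d n q H r) n
      ≡ (+ (n * d)) ℤ.- sumFin q (λ i → + ((n ∸ r i) * (∣ H i ∣ ∸ r i)))
lemma3p4 d n q 1≤n _ H r _ ∣H∩H∣+n≤r+r _ r≤n-1 r+1≤∣H∣ = SplitMatroid.naiveDim-split H r r<n r<∣H∣ ∣H∩H∣<r
  where
  r<n : ∀ i → r i < n
  r<n i = ≤-trans (s≤s (r≤n-1 i)) (≤-reflexive (m+[n∸m]≡n 1≤n))
  r<∣H∣ : ∀ i → r i < ∣ H i ∣
  r<∣H∣ i = subst (_≤ ∣ H i ∣) (+-comm (r i) 1) (r+1≤∣H∣ i)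
  ∣H∩H∣<r : ∀ {i j} → i ≢ j → ∣ H i ∩ H j ∣ < r j
  ∣H∩H∣<r {i} {j} i≢j = a+n≤b+c∧b<n⇒a<c (∣H∩H∣+n≤r+r i j i≢j) (r<n i)
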